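{- Let $n$ be an even positive integer. The digraph $\vec{C}_n\wr \vec{C}_4$ is hamiltonian decomposable.
   Context: $\vec{C}_k$ denotes the directed $k$-cycle. A digraph is hamiltonian decomposable if its arc set can be partitioned into directed hamiltonian cycles. The wreath product $G \wr H$ has vertex set $V(G)\times V(H)$, with $((g_1,h_1),(g_2,h_2))$ an arc iff $(g_1,g_2)\in A(G)$, or $g_1=g_2$ and $(h_1,h_2)\in A(H)$. -}

module Defs where

open import Data.Nat using (ℕ; zero; suc; _+_; _*_)
open import Data.Fin using (Fin; toℕ)
open import Data.Product using (Σ; _×_; _,_; ∃; ∃-syntax)
open import Relation.Binary.PropositionalEquality using (_≡_)
open import Function.Definitions using (Bijective)
open import Function using (_∘_)

Digraph : Set → Set₁
Digraph V = V → V → Set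

sucMod : ∀ {k} → Fin k → Fin k
sucMod {suc k} i = Data.Fin.fromℕ< {((toℕ i) + 1) Data.Nat.% suc k}
                     (Data.Nat.DivMod.m%n<n (toℕ i + 1) (suc k))
  where import Data.Nat.DivMod

DirCycle : (k : ℕ) → Digraph (Fin k)
DirCycle k i j = sucMod i ≡ j

data Wreath {VG VH : Set} (G : Digraph VG) (H : Digraph VH)
     : VG × VH → VG × VH → Set where
  outer : ∀ {g₁ g₂ h₁ h₂} → G g₁ g₂ → Wreath G H (g₁ , h₁) (g₂ , h₂)
  inner : ∀ {g h₁ h₂} → H h₁ h₂ → Wreath G H (g , h₁) (g , h₂)

record HamCycle {V : Set} (N : ℕ) (D : Digraph V) : Set where
  field
    vtx     : Fin N → V
    bij     : Bijective _≡_ _≡_ vtx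
    isCycle : ∀ i → D (vtx i) (vtx (sucMod i))

UsesArc : ∀ {V N} {D : Digraph V} → HamCycle N D → V → V → Set
UsesArc C u w = ∃[ i ] (HamCycle.vtx C i ≡ u × HamCycle.vtx C (sucMod i) ≡ w)

-- D (with N vertices) is hamiltonian decomposable: there is a family of
-- hamiltonian cycles C₀,…,C_{m-1} such that every arc of D is traversed by
-- exactly one cycle of the family (cycles only use arcs of D, so the arc sets
-- of the cycles partition A(D)).
HamDecomposable : {V : Set} (N : ℕ) → Digraph V → Set
HamDecomposable {V} N D =
  ∃[ m ] Σ (Fin m → HamCycle N D) λ C →
    ∀ u w → D u w →
      ∃[ j ] (UsesArc (C j) u w × (∀ j′ → UsesArc (C j′) u w → j′ ≡ j))

-- Write n = 2p and group the vertices of C_n into the p blocks {2q, 2q + 1}.  A vertex (g , h)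
-- of C_n ≀ C_4 has five out-arcs: one inside its copy of C_4 and four into the next copy.  Each
-- of the five hamiltonian cycles is given by a rule choosing the out-arc of (g , h) from its
-- local type only: the parity of g, whether g lies in the last block, and h.  At every local
-- type the five rules choose the five out-arcs once each, so the cycles partition the arcs.
-- A rule traces a single cycle because it also labels the eight vertices of a block by pairs
-- (ℓ , t) so that the vertex of block q labelled (ℓ , t) is reached after
-- p (s₀ + … + s_{ℓ-1}) + q s_ℓ + t steps: in its ℓ-th sweep the cycle passes through the blocks
-- in order, spending s_ℓ steps in each.  That every step advances this count by one (mod 8p)
-- is a finite set of local conditions on the rule, checked by evaluation.

module Submission where

open import Defs
open import Data.Nat using (ℕ; zero; suc; _+_; _*_; _>_; _<_; _≤_; z≤n; s≤s; _≟_; _<?_; NonZero; >-nonZero)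
open import Data.Nat.Properties
open import Data.Nat.DivMod using (_%_; m<n⇒m%n≡m; n%n≡0; [m+kn]%n≡m%n)
open import Data.Nat.Divisibility using (_∣_; divides)
open import Data.Bool using (Bool; true; false)
open import Data.Fin as Fin using (Fin; toℕ; fromℕ; fromℕ<; inject₁; combine; remQuot)
open import Data.Fin.Patterns using (0F; 1F; 2F; 3F; 4F)
import Data.Fin.Properties as Finₚ
open import Data.Product using (∃-syntax; _×_; _,_; proj₁; proj₂; uncurry)
open import Data.Product.Properties using (≡-dec)
open import Data.Unit using (tt)
open import Data.Vec using (Vec; []; _∷_; lookup)
open import Data.Sum using (_⊎_; inj₁; inj₂; [_,_])
open import Function using (_∘_)
open import Function.Definitions using (Injective)
open import Relation.Binary.Definitions using (tri<; tri≈; tri>)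
open import Relation.Binary.PropositionalEquality using (_≡_; _≢_; refl; sym; trans; cong; cong₂; subst; subst₂; module ≡-Reasoning)
open import Relation.Nullary using (Dec; yes; no; does; contradiction)
open import Relation.Nullary.Decidable using (map′; toWitness; _×-dec_; _⊎-dec_; _→-dec_)
open import Relation.Unary using (Decidable)

-- b is a + 1 modulo L, except that `step` also admits b = L when a + 1 = L:
-- the bound b < L is always supplied separately.
data Next (L a b : ℕ) : Set where
  step : b ≡ suc a → Next L a b
  wrap : b ≡ 0 → suc a ≡ L → Next L a b

next? : ∀ L a b → Dec (Next L a b)
next? L a b = map′ [ step , uncurry wrap ] toSum (b ≟ suc a ⊎-dec (b ≟ 0 ×-dec suc a ≟ L))
  where
  toSum : Next L a b → b ≡ suc a ⊎ (b ≡ 0 × suc a ≡ L)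
  toSum (step e)     = inj₁ e
  toSum (wrap e₀ eL) = inj₂ (e₀ , eL)

Next-unique : ∀ {L a b b′} → b < L → b′ < L → Next L a b → Next L a b′ → b ≡ b′
Next-unique _    _     (step e)    (step e′)    = trans e (sym e′)
Next-unique _    _     (wrap e₀ _) (wrap e₀′ _) = trans e₀ (sym e₀′)
Next-unique b<L  _     (step e)    (wrap _ eL)  = contradiction (trans e eL) (<⇒≢ b<L)
Next-unique _    b′<L  (wrap _ eL) (step e′)    = contradiction (trans e′ eL) (<⇒≢ b′<L)

isLast : ∀ {L} → Fin L → Bool
isLast {L} i = does (suc (toℕ i) ≟ L)

data SucModView {L} (i : Fin L) : Bool → Set where
  notLast : toℕ (sucMod i) ≡ suc (toℕ i) → SucModView i false
  last    : suc (toℕ i) ≡ L → toℕ (sucMod i) ≡ 0 → SucModView i true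

toℕ-sucMod-% : ∀ {L} (i : Fin (suc L)) → toℕ (sucMod i) ≡ suc (toℕ i) % suc L
toℕ-sucMod-% {L} i = trans (Finₚ.toℕ-fromℕ< _) (cong (_% suc L) (+-comm (toℕ i) 1))

sucModView : ∀ {L} (i : Fin L) → SucModView i (isLast i)
sucModView {suc L} i = view (suc (toℕ i) ≟ suc L)
  where
  view : (d : Dec (suc (toℕ i) ≡ suc L)) → SucModView i (does d)
  view (yes i+1≡L) = last i+1≡L (trans (toℕ-sucMod-% i) (trans (cong (_% suc L) i+1≡L) (n%n≡0 (suc L))))
  view (no  i+1≢L) = notLast (trans (toℕ-sucMod-% i) (m<n⇒m%n≡m (≤∧≢⇒< (Finₚ.toℕ<n i) i+1≢L)))

toℕ-sucMod : ∀ {L} (i : Fin L) → Next L (toℕ i) (toℕ (sucMod i))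
toℕ-sucMod i with isLast i | sucModView i
... | false | notLast e = step e
... | true  | last eL e₀ = wrap e₀ eL

sucMod-≢ : ∀ {L} (i : Fin L) → 1 < L → sucMod i ≢ i
sucMod-≢ i 1<L sucModi≡i with toℕ-sucMod i
... | step e     = 1+n≢n (trans (sym e) (cong toℕ sucModi≡i))
... | wrap e₀ eL = <-irrefl (trans (cong suc (sym toℕi≡0)) eL) 1<L
  where
  toℕi≡0 : toℕ i ≡ 0
  toℕi≡0 = trans (cong toℕ (sym sucModi≡i)) e₀

record SuccessorCycle {V : Set} (L : ℕ) (D : Digraph V) : Set where
  field
    next          : V → V
    next-arc      : ∀ v → D v (next v)
    pos           : V → ℕ
    pos-<         : ∀ v → pos v < L
    pos-injective : Injective _≡_ _≡_ pos
    origin        : V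
    pos-origin    : pos origin ≡ 0
    pos-next      : ∀ v → Next L (pos v) (pos (next v))

module _ {V : Set} {L : ℕ} {D : Digraph V} (C : SuccessorCycle L D) where
  open SuccessorCycle C
  open import Function.Endo.Propositional V using (_^_)

  private
    walk : Fin L → V
    walk i = (next ^ toℕ i) origin

    next-after : ∀ {v a} → pos v ≡ a → Next L a (pos (next v))
    next-after {v} e = subst (λ a → Next L a (pos (next v))) e (pos-next v)

    pos-iterate : ∀ k → k < L → pos ((next ^ k) origin) ≡ k
    pos-iterate zero    _     = pos-origin
    pos-iterate (suc k) k+1<L = Next-unique (pos-< _) k+1<L
      (next-after (pos-iterate k (<-trans (n<1+n k) k+1<L))) (step refl)

    pos-walk : ∀ i → pos (walk i) ≡ toℕ i
    pos-walk i = pos-iterate (toℕ i) (Finₚ.toℕ<n i)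

    walk-pos : ∀ v → walk (fromℕ< (pos-< v)) ≡ v
    walk-pos v = pos-injective (trans (pos-walk _) (Finₚ.toℕ-fromℕ< (pos-< v)))

    walk-sucMod : ∀ i → walk (sucMod i) ≡ next (walk i)
    walk-sucMod i = pos-injective (trans (pos-walk (sucMod i))
      (Next-unique (Finₚ.toℕ<n _) (pos-< _)
        (toℕ-sucMod i) (next-after (pos-walk i))))

    walk-injective : Injective _≡_ _≡_ walk
    walk-injective {i} {j} e = Finₚ.toℕ-injective (trans (sym (pos-walk i)) (trans (cong pos e) (pos-walk j)))

  toHamCycle : HamCycle L D
  toHamCycle = record
    { vtx     = walk
    ; bij     = walk-injective , λ v → fromℕ< (pos-< v) , λ { refl → walk-pos v }
    ; isCycle = λ i → subst (D (walk i)) (sym (walk-sucMod i)) (next-arc (walk i))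
    }

  usesArc⇒next : ∀ {u w} → UsesArc toHamCycle u w → next u ≡ w
  usesArc⇒next (i , refl , refl) = sym (walk-sucMod i)

  usesArc-next : ∀ u → UsesArc toHamCycle u (next u)
  usesArc-next u = fromℕ< (pos-< u) , walk-pos u , trans (walk-sucMod _) (cong next (walk-pos u))

successorCycles⇒hamDecomposable : ∀ {V L m} {D : Digraph V} (C : Fin m → SuccessorCycle L D) →
  (∀ u w → D u w → ∃[ j ] (SuccessorCycle.next (C j) u ≡ w ×
                          ∀ j′ → SuccessorCycle.next (C j′) u ≡ w → j′ ≡ j)) →
  HamDecomposable L D
successorCycles⇒hamDecomposable {m = m} {D} C unique = m , toHamCycle ∘ C , usedOnce
  where
  usedOnce : ∀ u w → D u w → ∃[ j ] (UsesArc (toHamCycle (C j)) u w ×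
                                    ∀ j′ → UsesArc (toHamCycle (C j′)) u w → j′ ≡ j)
  usedOnce u w uw with unique u w uw
  ... | j , refl , only-j = j , usesArc-next (C j) u , λ j′ uses → only-j j′ (usesArc⇒next (C j′) uses)

Next-scale : ∀ {L a b} c → Next L a b → Next (L * suc c) (suc c * a + c) (suc c * b)
Next-scale {a = a} c (step e) = step (begin
  suc c * _          ≡⟨ cong (suc c *_) e ⟩
  suc c * suc a      ≡⟨ *-suc (suc c) a ⟩
  suc c + suc c * a  ≡⟨ +-comm (suc c) _ ⟩
  suc c * a + suc c  ≡⟨ +-suc _ c ⟩
  suc (suc c * a + c) ∎)
  where open ≡-Reasoning
Next-scale {L} {a} c (wrap e₀ eL) = wrap (trans (cong (suc c *_) e₀) (*-zeroʳ c)) (begin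
  suc (suc c * a + c) ≡⟨ sym (+-suc _ c) ⟩
  suc c * a + suc c   ≡⟨ +-comm _ (suc c) ⟩
  suc c + suc c * a   ≡⟨ sym (*-suc (suc c) a) ⟩
  suc c * suc a       ≡⟨ cong (suc c *_) eL ⟩
  suc c * L           ≡⟨ *-comm (suc c) L ⟩
  L * suc c           ∎)
  where open ≡-Reasoning

sucMod-combine-inject₁ : ∀ {m n} (q : Fin m) (r : Fin n) →
  sucMod (combine q (inject₁ r)) ≡ combine q (Fin.suc r)
sucMod-combine-inject₁ {n = n} q r = Finₚ.toℕ-injective
  (Next-unique (Finₚ.toℕ<n _) (Finₚ.toℕ<n _) (toℕ-sucMod (combine q (inject₁ r))) (step (begin
    toℕ (combine q (Fin.suc r))            ≡⟨ Finₚ.toℕ-combine q (Fin.suc r) ⟩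
    suc n * toℕ q + suc (toℕ r)            ≡⟨ +-suc _ (toℕ r) ⟩
    suc (suc n * toℕ q + toℕ r)            ≡⟨ cong (λ x → suc (suc n * toℕ q + x)) (Finₚ.toℕ-inject₁ r) ⟨
    suc (suc n * toℕ q + toℕ (inject₁ r))  ≡⟨ cong suc (Finₚ.toℕ-combine q (inject₁ r)) ⟨
    suc (toℕ (combine q (inject₁ r)))      ∎)))
  where open ≡-Reasoning

sucMod-combine-fromℕ : ∀ {m n} (q : Fin m) →
  sucMod (combine q (fromℕ n)) ≡ combine (sucMod q) Fin.zero
sucMod-combine-fromℕ {m} {n} q = Finₚ.toℕ-injective
  (Next-unique (Finₚ.toℕ<n _) (Finₚ.toℕ<n _) (toℕ-sucMod (combine q (fromℕ n)))
    (subst₂ (Next (m * suc n)) (sym toℕ-last) (sym toℕ-first) (Next-scale n (toℕ-sucMod q))))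
  where
  toℕ-last : toℕ (combine q (fromℕ n)) ≡ suc n * toℕ q + n
  toℕ-last = trans (Finₚ.toℕ-combine q (fromℕ n)) (cong (suc n * toℕ q +_) (Finₚ.toℕ-fromℕ n))
  toℕ-first : toℕ (combine (sucMod q) (Fin.zero {n})) ≡ suc n * toℕ (sucMod q)
  toℕ-first = trans (Finₚ.toℕ-combine (sucMod q) Fin.zero) (+-identityʳ _)

prefixSum : (ℕ → ℕ) → ℕ → ℕ
prefixSum f zero    = 0
prefixSum f (suc n) = prefixSum f n + f n

prefixSum-*ˡ : ∀ c f n → prefixSum (λ i → c * f i) n ≡ c * prefixSum f n
prefixSum-*ˡ c f zero    = sym (*-zeroʳ c)
prefixSum-*ˡ c f (suc n) = trans (cong (_+ c * f n) (prefixSum-*ˡ c f n)) (sym (*-distribˡ-+ c _ (f n)))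

prefixSum-mono-≤ : ∀ f {m n} → m ≤ n → prefixSum f m ≤ prefixSum f n
prefixSum-mono-≤ f {n = zero}      z≤n = ≤-refl
prefixSum-mono-≤ f {m} {n = suc n} m≤1+n with m≤n⇒m<n∨m≡n m≤1+n
... | inj₁ (s≤s m≤n) = ≤-trans (prefixSum-mono-≤ f m≤n) (m≤m+n _ (f n))
... | inj₂ refl      = ≤-refl

prefixSum-+-< : ∀ f {ℓ m x} → ℓ < m → x < f ℓ → prefixSum f ℓ + x < prefixSum f m
prefixSum-+-< f {ℓ} ℓ<m x<fℓ = <-≤-trans (+-monoʳ-< (prefixSum f ℓ) x<fℓ) (prefixSum-mono-≤ f ℓ<m)

prefixSum-+-injective : ∀ f {ℓ ℓ′ x x′} → x < f ℓ → x′ < f ℓ′ →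
  prefixSum f ℓ + x ≡ prefixSum f ℓ′ + x′ → ℓ ≡ ℓ′ × x ≡ x′
prefixSum-+-injective f {ℓ} {ℓ′} {x} {x′} x<fℓ x′<fℓ′ e with <-cmp ℓ ℓ′
... | tri< ℓ<ℓ′ _ _ = contradiction e (<⇒≢ (<-≤-trans (prefixSum-+-< f ℓ<ℓ′ x<fℓ) (m≤m+n _ x′)))
... | tri≈ _ refl _ = refl , +-cancelˡ-≡ (prefixSum f ℓ) x x′ e
... | tri> _ _ ℓ′<ℓ = contradiction (sym e) (<⇒≢ (<-≤-trans (prefixSum-+-< f ℓ′<ℓ x′<fℓ′) (m≤m+n _ x)))

q*k+t<p*k : ∀ {k p q t} → q < p → t < k → q * k + t < p * k
q*k+t<p*k {k} {p} {q} {t} q<p t<k = begin-strict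
  q * k + t  <⟨ +-monoʳ-< (q * k) t<k ⟩
  q * k + k  ≡⟨ +-comm (q * k) k ⟩
  suc q * k  ≤⟨ *-monoˡ-≤ k q<p ⟩
  p * k      ∎
  where open ≤-Reasoning

q*k+t-injective : ∀ {k q q′ t t′} → t < k → t′ < k → q * k + t ≡ q′ * k + t′ → q ≡ q′ × t ≡ t′
q*k+t-injective {k} {q} {q′} {t} {t′} t<k t′<k e = q≡q′ , t≡t′
  where
  instance
    k≢0 : NonZero k
    k≢0 = >-nonZero (≤-<-trans z≤n t<k)

  remainder-≡ : ∀ a {b} → b < k → (a * k + b) % k ≡ b
  remainder-≡ a {b} b<k = trans (cong (_% k) (+-comm (a * k) b)) (trans ([m+kn]%n≡m%n b a k) (m<n⇒m%n≡m b<k))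

  t≡t′ : t ≡ t′
  t≡t′ = trans (sym (remainder-≡ q t<k)) (trans (cong (_% k) e) (remainder-≡ q′ t′<k))

  q≡q′ : q ≡ q′
  q≡q′ = *-cancelʳ-≡ q q′ k (+-cancelʳ-≡ t (q * k) (q′ * k) (trans e (cong (q′ * k +_) (sym t≡t′))))

q*k+t+1≡[q+1]*k : ∀ {k} q {t} → suc t ≡ k → suc (q * k + t) ≡ suc q * k
q*k+t+1≡[q+1]*k q {t} refl = cong suc (+-comm (q * suc t) t)

Label : Set
Label = ℕ × ℕ

_≟-Label_ : (a b : Label) → Dec (a ≡ b)
_≟-Label_ = ≡-dec _≟_ _≟_

nextOffset : Label → Label
nextOffset (ℓ , t) = ℓ , suc t

module Positions (p : ℕ) (size : ℕ → ℕ) where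

  sweepStart : ℕ → ℕ
  sweepStart = prefixSum (λ ℓ → p * size ℓ)

  position : ℕ → Label → ℕ
  position q (ℓ , t) = sweepStart ℓ + (q * size ℓ + t)

  position-suc-offset : ∀ q a → position q (nextOffset a) ≡ suc (position q a)
  position-suc-offset q (ℓ , t) = trans (cong (sweepStart ℓ +_) (+-suc (q * size ℓ) t)) (+-suc (sweepStart ℓ) _)

  position-sweepStart : ∀ ℓ → position 0 (ℓ , 0) ≡ sweepStart ℓ
  position-sweepStart ℓ = +-identityʳ (sweepStart ℓ)

  position-next-block : ∀ q ℓ t → suc t ≡ size ℓ → position (suc q) (ℓ , 0) ≡ suc (position q (ℓ , t))
  position-next-block q ℓ t t+1≡size = begin
    sweepStart ℓ + (suc q * size ℓ + 0)   ≡⟨ cong (sweepStart ℓ +_) (+-identityʳ _) ⟩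
    sweepStart ℓ + suc q * size ℓ         ≡⟨ cong (sweepStart ℓ +_) (q*k+t+1≡[q+1]*k q t+1≡size) ⟨
    sweepStart ℓ + suc (q * size ℓ + t)   ≡⟨ +-suc _ _ ⟩
    suc (position q (ℓ , t))              ∎
    where open ≡-Reasoning

  position-last-block : ∀ q ℓ t → suc q ≡ p → suc t ≡ size ℓ → suc (position q (ℓ , t)) ≡ sweepStart (suc ℓ)
  position-last-block q ℓ t q+1≡p t+1≡size = begin
    suc (sweepStart ℓ + (q * size ℓ + t))  ≡⟨ +-suc _ _ ⟨
    sweepStart ℓ + suc (q * size ℓ + t)    ≡⟨ cong (sweepStart ℓ +_) (q*k+t+1≡[q+1]*k q t+1≡size) ⟩
    sweepStart ℓ + suc q * size ℓ          ≡⟨ cong (λ x → sweepStart ℓ + x * size ℓ) q+1≡p ⟩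
    sweepStart (suc ℓ)                     ∎
    where open ≡-Reasoning

  position-< : ∀ {q ℓ t m} → q < p → ℓ < m → t < size ℓ → position q (ℓ , t) < sweepStart m
  position-< q<p ℓ<m t<size = prefixSum-+-< (λ ℓ → p * size ℓ) ℓ<m (q*k+t<p*k q<p t<size)

  position-injective : ∀ {q q′ ℓ ℓ′ t t′} → q < p → q′ < p → t < size ℓ → t′ < size ℓ′ →
    position q (ℓ , t) ≡ position q′ (ℓ′ , t′) → q ≡ q′ × (ℓ , t) ≡ (ℓ′ , t′)
  position-injective {q} {q′} q<p q′<p t<size t′<size e
    with prefixSum-+-injective (λ ℓ → p * size ℓ) (q*k+t<p*k q<p t<size) (q*k+t<p*k q′<p t′<size) e
  ... | refl , e′ with q*k+t-injective {q = q} {q′} t<size t′<size e′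
  ... | refl , refl = refl , refl

data Move (k : ℕ) : Set where
  stay : Move k
  jump : Fin k → Move k

_≟-Move_ : ∀ {k} (mv mv′ : Move k) → Dec (mv ≡ mv′)
stay    ≟-Move stay     = yes refl
stay    ≟-Move jump _   = no λ ()
jump _  ≟-Move stay     = no λ ()
jump h  ≟-Move jump h′  = map′ (cong jump) (λ { refl → refl }) (h Finₚ.≟ h′)

all-Move? : ∀ {k} {P : Move k → Set} → Decidable P → Dec (∀ mv → P mv)
all-Move? P? = map′ (λ (s , j) → λ { stay → s ; (jump h) → j h }) (λ all → all stay , all ∘ jump)
                    (P? stay ×-dec Finₚ.all? (P? ∘ jump))

all-Bool? : {P : Bool → Set} → Decidable P → Dec (∀ b → P b)
all-Bool? P? = map′ (λ (f , t) → λ { false → f ; true → t }) (λ all → all false , all true)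
                    (P? false ×-dec P? true)

module _ {n k : ℕ} where

  target : Fin n × Fin k → Move k → Fin n × Fin k
  target (g , h) stay      = g , sucMod h
  target (g , h) (jump h′) = sucMod g , h′

  target-arc : ∀ v mv → Wreath (DirCycle n) (DirCycle k) v (target v mv)
  target-arc (g , h) stay      = inner refl
  target-arc (g , h) (jump h′) = outer refl

  arc⇒target : ∀ {v w} → Wreath (DirCycle n) (DirCycle k) v w → ∃[ mv ] target v mv ≡ w
  arc⇒target (outer refl) = jump _ , refl
  arc⇒target (inner refl) = stay , refl

  target-injective : 1 < n → ∀ v {mv mv′} → target v mv ≡ target v mv′ → mv ≡ mv′
  target-injective _   _       {stay}   {stay}   _ = refl
  target-injective _   _       {jump _} {jump _} e = cong (jump ∘ proj₂) e
  target-injective 1<n (g , _) {stay}   {jump _} e = contradiction (sym (cong proj₁ e)) (sucMod-≢ g 1<n)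
  target-injective 1<n (g , _) {jump _} {stay}   e = contradiction (cong proj₁ e) (sucMod-≢ g 1<n)

-- A rule fixes, for each local type (o , l , h) (o the parity of g, l whether its block is the
-- last one), the out-arc taken and the label placing the vertex at `position q (ℓ , t)`.  Labels
-- of even vertices cannot depend on l: the jump entering a block does not know whether it is last.
record Rule : Set where
  field
    sweeps                                        : ℕ
    size                                          : ℕ → ℕ
    evenLabels oddLabels lastOddLabels            : Vec Label 4
    evenMoves lastEvenMoves oddMoves lastOddMoves : Vec (Move 4) 4

  label : Fin 2 → Bool → Fin 4 → Label
  label 0F _     = lookup evenLabels
  label 1F false = lookup oddLabels
  label 1F true  = lookup lastOddLabels

  move : Fin 2 → Bool → Fin 4 → Move 4
  move 0F false = lookup evenMoves
  move 0F true  = lookup lastEvenMoves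
  move 1F false = lookup oddMoves
  move 1F true  = lookup lastOddMoves

  InRange : Label → Set
  InRange (ℓ , t) = ℓ < sweeps × t < size ℓ

  EntersNextBlock : Label → Label → Set
  EntersNextBlock (ℓ , t) a = suc t ≡ size ℓ × a ≡ (ℓ , 0)

  EntersNextSweep : Label → Label → Set
  EntersNextSweep (ℓ , t) (ℓ′ , t′) = suc t ≡ size ℓ × Next sweeps ℓ ℓ′ × t′ ≡ 0

  Advances : Fin 2 → Bool → Fin 4 → Move 4 → Set
  Advances o  l     h stay      = label o l (sucMod h) ≡ nextOffset (label o l h)
  Advances 0F l     h (jump h′) = label 1F l h′ ≡ nextOffset (label 0F l h)
  Advances 1F false h (jump h′) = EntersNextBlock (label 1F false h) (lookup evenLabels h′)
  Advances 1F true  h (jump h′) = EntersNextSweep (label 1F true h) (lookup evenLabels h′)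

  advances? : ∀ o l h mv → Dec (Advances o l h mv)
  advances? o  l     h stay      = label o l (sucMod h) ≟-Label _
  advances? 0F l     h (jump h′) = label 1F l h′ ≟-Label _
  advances? 1F false h (jump h′) = (_ ≟ _) ×-dec (lookup evenLabels h′ ≟-Label _)
  advances? 1F true  h (jump h′) = (_ ≟ _) ×-dec next? _ _ _ ×-dec (_ ≟ _)

module _ (R : Rule) where
  open Rule R

  record Valid : Set where
    field
      moves-advance    : ∀ o l h → Advances o l h (move o l h)
      labels-in-range  : ∀ o l h → InRange (label o l h)
      labels-injective : ∀ l o o′ h h′ → label o l h ≡ label o′ l h′ → o ≡ o′ × h ≡ h′
      sizes-sum        : prefixSum size sweeps ≡ 8
      start-label      : ∃[ h ] lookup evenLabels h ≡ (0 , 0)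

  valid? : Dec Valid
  valid? = map′
    (λ (a , r , i , s , o) → record { moves-advance = a ; labels-in-range = r ; labels-injective = i
                                    ; sizes-sum = s ; start-label = o })
    (λ v → let open Valid v in moves-advance , labels-in-range , labels-injective , sizes-sum , start-label)
    (     (Finₚ.all? λ o → all-Bool? λ l → Finₚ.all? λ h → advances? o l h (move o l h))
    ×-dec (Finₚ.all? λ o → all-Bool? λ l → Finₚ.all? λ h → (_ <? _) ×-dec (_ <? _))
    ×-dec (all-Bool? λ l → Finₚ.all? λ o → Finₚ.all? λ o′ → Finₚ.all? λ h → Finₚ.all? λ h′ →
             (label o l h ≟-Label label o′ l h′) →-dec (o Finₚ.≟ o′ ×-dec h Finₚ.≟ h′))
    ×-dec (prefixSum size sweeps ≟ 8)
    ×-dec (Finₚ.any? λ h → lookup evenLabels h ≟-Label (0 , 0)))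

rule : Fin 5 → Rule
rule 0F = record
  { sweeps        = 2
  ; size          = λ { 0 → 2 ; _ → 6 }
  ; evenLabels    = (1 , 1) ∷ (1 , 2) ∷ (0 , 0) ∷ (1 , 0) ∷ []
  ; oddLabels     = (0 , 1) ∷ (1 , 3) ∷ (1 , 4) ∷ (1 , 5) ∷ []
  ; lastOddLabels = (0 , 1) ∷ (1 , 3) ∷ (1 , 4) ∷ (1 , 5) ∷ []
  ; evenMoves     = stay    ∷ jump 1F ∷ jump 0F ∷ stay    ∷ []
  ; lastEvenMoves = stay    ∷ jump 1F ∷ jump 0F ∷ stay    ∷ []
  ; oddMoves      = jump 2F ∷ stay    ∷ stay    ∷ jump 3F ∷ []
  ; lastOddMoves  = jump 3F ∷ stay    ∷ stay    ∷ jump 2F ∷ []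
  }
rule 1F = record
  { sweeps        = 3
  ; size          = λ { 1 → 2 ; _ → 3 }
  ; evenLabels    = (1 , 0) ∷ (2 , 0) ∷ (2 , 1) ∷ (0 , 0) ∷ []
  ; oddLabels     = (0 , 2) ∷ (2 , 2) ∷ (1 , 1) ∷ (0 , 1) ∷ []
  ; lastOddLabels = (0 , 1) ∷ (0 , 2) ∷ (2 , 2) ∷ (1 , 1) ∷ []
  ; evenMoves     = jump 2F ∷ stay    ∷ jump 1F ∷ jump 3F ∷ []
  ; lastEvenMoves = jump 3F ∷ stay    ∷ jump 2F ∷ jump 0F ∷ []
  ; oddMoves      = jump 3F ∷ jump 1F ∷ jump 0F ∷ stay    ∷ []
  ; lastOddMoves  = stay    ∷ jump 0F ∷ jump 3F ∷ jump 1F ∷ []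
  }
rule 2F = record
  { sweeps        = 3
  ; size          = λ { 2 → 4 ; _ → 2 }
  ; evenLabels    = (1 , 0) ∷ (0 , 0) ∷ (2 , 0) ∷ (2 , 1) ∷ []
  ; oddLabels     = (2 , 2) ∷ (2 , 3) ∷ (0 , 1) ∷ (1 , 1) ∷ []
  ; lastOddLabels = (2 , 3) ∷ (1 , 1) ∷ (0 , 1) ∷ (2 , 2) ∷ []
  ; evenMoves     = jump 3F ∷ jump 2F ∷ stay    ∷ jump 0F ∷ []
  ; lastEvenMoves = jump 1F ∷ jump 2F ∷ stay    ∷ jump 3F ∷ []
  ; oddMoves      = stay    ∷ jump 2F ∷ jump 1F ∷ jump 0F ∷ []
  ; lastOddMoves  = jump 1F ∷ jump 2F ∷ jump 0F ∷ stay    ∷ []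
  }
rule 3F = record
  { sweeps        = 4
  ; size          = λ _ → 2
  ; evenLabels    = (0 , 0) ∷ (3 , 0) ∷ (1 , 0) ∷ (2 , 0) ∷ []
  ; oddLabels     = (0 , 1) ∷ (2 , 1) ∷ (1 , 1) ∷ (3 , 1) ∷ []
  ; lastOddLabels = (0 , 1) ∷ (1 , 1) ∷ (2 , 1) ∷ (3 , 1) ∷ []
  ; evenMoves     = jump 0F ∷ jump 3F ∷ jump 2F ∷ jump 1F ∷ []
  ; lastEvenMoves = jump 0F ∷ jump 3F ∷ jump 1F ∷ jump 2F ∷ []
  ; oddMoves      = jump 0F ∷ jump 3F ∷ jump 2F ∷ jump 1F ∷ []
  ; lastOddMoves  = jump 2F ∷ jump 3F ∷ jump 1F ∷ jump 0F ∷ []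
  }
rule 4F = record
  { sweeps        = 4
  ; size          = λ _ → 2
  ; evenLabels    = (0 , 0) ∷ (3 , 0) ∷ (1 , 0) ∷ (2 , 0) ∷ []
  ; oddLabels     = (3 , 1) ∷ (0 , 1) ∷ (2 , 1) ∷ (1 , 1) ∷ []
  ; lastOddLabels = (3 , 1) ∷ (2 , 1) ∷ (0 , 1) ∷ (1 , 1) ∷ []
  ; evenMoves     = jump 1F ∷ jump 0F ∷ jump 3F ∷ jump 2F ∷ []
  ; lastEvenMoves = jump 2F ∷ jump 0F ∷ jump 3F ∷ jump 1F ∷ []
  ; oddMoves      = jump 1F ∷ jump 0F ∷ jump 3F ∷ jump 2F ∷ []
  ; lastOddMoves  = jump 0F ∷ jump 1F ∷ jump 2F ∷ jump 3F ∷ []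
  }

rules-valid : ∀ j → Valid (rule j)
rules-valid = toWitness {a? = Finₚ.all? (valid? ∘ rule)} tt

moves-partition : ∀ o l h mv → ∃[ j ] (Rule.move (rule j) o l h ≡ mv ×
                                      ∀ j′ → Rule.move (rule j′) o l h ≡ mv → j′ ≡ j)
moves-partition = toWitness {a? = Finₚ.all? λ o → all-Bool? λ l → Finₚ.all? λ h → all-Move? λ mv →
  Finₚ.any? λ j → (Rule.move (rule j) o l h ≟-Move mv) ×-dec
    Finₚ.all? λ j′ → (Rule.move (rule j′) o l h ≟-Move mv) →-dec (j′ Finₚ.≟ j)} tt

module _ (m : ℕ) where

  private
    p : ℕ
    p = suc m

    V : Set
    V = Fin (p * 2) × Fin 4

    D : Digraph V
    D = Wreath (DirCycle (p * 2)) (DirCycle 4)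

    L : ℕ
    L = p * 2 * 4

    block : Fin (p * 2) → Fin p
    block g = proj₁ (remQuot {p} 2 g)

    parity : Fin (p * 2) → Fin 2
    parity g = proj₂ (remQuot {p} 2 g)

    combine-block-parity : ∀ g → combine (block g) (parity g) ≡ g
    combine-block-parity = Finₚ.combine-remQuot {p} 2

  module _ (R : Rule) (valid : Valid R) where
    open Rule R
    open Valid valid
    open Positions p size

    private
      posAt : Fin p → Fin 2 → Fin 4 → ℕ
      posAt q o h = position (toℕ q) (label o (isLast q) h)

      rulePos : V → ℕ
      rulePos (g , h) = posAt (block g) (parity g) h

      ruleNext : V → V
      ruleNext (g , h) = target (g , h) (move (parity g) (isLast (block g)) h)

      rulePos-combine : ∀ q o h → rulePos (combine q o , h) ≡ posAt q o h
      rulePos-combine q o h = cong (λ (q′ , o′) → posAt q′ o′ h) (Finₚ.remQuot-combine {p} q o)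

      ruleNext-combine : ∀ q o h → ruleNext (combine q o , h) ≡ target (combine q o , h) (move o (isLast q) h)
      ruleNext-combine q o h =
        cong (λ (q′ , o′) → target (combine q o , h) (move o′ (isLast q′) h)) (Finₚ.remQuot-combine {p} q o)

      blocks-total : sweepStart sweeps ≡ L
      blocks-total = trans (prefixSum-*ˡ p size sweeps) (trans (cong (p *_) sizes-sum) (sym (*-assoc p 2 4)))

      posAt-< : ∀ q o h → posAt q o h < L
      posAt-< q o h = let (ℓ<sweeps , t<size) = labels-in-range o (isLast q) h in
        subst (posAt q o h <_) blocks-total (position-< (Finₚ.toℕ<n q) ℓ<sweeps t<size)

      posAt-injective : ∀ {q o h q′ o′ h′} → posAt q o h ≡ posAt q′ o′ h′ → q ≡ q′ × o ≡ o′ × h ≡ h′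
      posAt-injective {q} {o} {h} {q′} {o′} {h′} e
        with position-injective (Finₚ.toℕ<n q) (Finₚ.toℕ<n q′)
               (proj₂ (labels-in-range o (isLast q) h)) (proj₂ (labels-in-range o′ (isLast q′) h′)) e
      ... | toℕq≡toℕq′ , labels≡ with Finₚ.toℕ-injective toℕq≡toℕq′
      ... | refl = let (o≡o′ , h≡h′) = labels-injective (isLast q) o o′ h h′ labels≡ in refl , o≡o′ , h≡h′

      rulePos-injective : Injective _≡_ _≡_ rulePos
      rulePos-injective {g , h} {g′ , h′} e
        with posAt-injective {block g} {parity g} {h} {block g′} {parity g′} {h′} e
      ... | q≡q′ , o≡o′ , refl = cong (_, h) (begin
        g                               ≡⟨ combine-block-parity g ⟨
        combine (block g) (parity g)    ≡⟨ cong₂ combine q≡q′ o≡o′ ⟩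
        combine (block g′) (parity g′)  ≡⟨ combine-block-parity g′ ⟩
        g′                              ∎)
        where open ≡-Reasoning

      leaveBlock : ∀ {q l} h h′ → SucModView q l → Advances 1F l h (jump h′) →
        Next L (position (toℕ q) (label 1F l h)) (position (toℕ (sucMod q)) (lookup evenLabels h′))
      leaveBlock {q} h h′ (notLast sucModq≡q+1) (t+1≡size , entry≡) = step (begin
        position (toℕ (sucMod q)) (lookup evenLabels h′)  ≡⟨ cong₂ position sucModq≡q+1 entry≡ ⟩
        position (suc (toℕ q)) (ℓ , 0)                    ≡⟨ position-next-block (toℕ q) ℓ t t+1≡size ⟩
        suc (position (toℕ q) (ℓ , t))                    ∎)
        where
        open ≡-Reasoning
        ℓ = proj₁ (lookup oddLabels h)
        t = proj₂ (lookup oddLabels h)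
      leaveBlock {q} h h′ (last q+1≡p sucModq≡0) (t+1≡size , nextSweep , offset≡0) = fromSweep nextSweep
        where
        ℓ = proj₁ (lookup lastOddLabels h)
        t = proj₂ (lookup lastOddLabels h)
        ℓ′ = proj₁ (lookup evenLabels h′)

        entry : position (toℕ (sucMod q)) (lookup evenLabels h′) ≡ sweepStart ℓ′
        entry = trans (cong₂ position sucModq≡0 (cong (ℓ′ ,_) offset≡0)) (position-sweepStart ℓ′)

        exit : suc (position (toℕ q) (ℓ , t)) ≡ sweepStart (suc ℓ)
        exit = position-last-block (toℕ q) ℓ t q+1≡p t+1≡size

        fromSweep : Next sweeps ℓ ℓ′ → Next L (position (toℕ q) (ℓ , t)) (position (toℕ (sucMod q)) (lookup evenLabels h′))
        fromSweep (step ℓ′≡ℓ+1)          = step (trans entry (trans (cong sweepStart ℓ′≡ℓ+1) (sym exit)))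
        fromSweep (wrap ℓ′≡0 ℓ+1≡sweeps) = wrap (trans entry (cong sweepStart ℓ′≡0))
                                                (trans exit (trans (cong sweepStart ℓ+1≡sweeps) blocks-total))

      advance : ∀ q o h mv → Advances o (isLast q) h mv → Next L (posAt q o h) (rulePos (target (combine q o , h) mv))
      advance q o h stay adv = step (begin
        rulePos (combine q o , sucMod h)                      ≡⟨ rulePos-combine q o (sucMod h) ⟩
        position (toℕ q) (label o (isLast q) (sucMod h))      ≡⟨ cong (position (toℕ q)) adv ⟩
        position (toℕ q) (nextOffset (label o (isLast q) h))  ≡⟨ position-suc-offset (toℕ q) (label o (isLast q) h) ⟩
        suc (posAt q o h)                                     ∎)
        where open ≡-Reasoning
      advance q 0F h (jump h′) adv = step (begin
        rulePos (sucMod (combine q 0F) , h′)                   ≡⟨ cong (λ g → rulePos (g , h′)) (sucMod-combine-inject₁ q 0F) ⟩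
        rulePos (combine q 1F , h′)                            ≡⟨ rulePos-combine q 1F h′ ⟩
        position (toℕ q) (label 1F (isLast q) h′)              ≡⟨ cong (position (toℕ q)) adv ⟩
        position (toℕ q) (nextOffset (label 0F (isLast q) h))  ≡⟨ position-suc-offset (toℕ q) (label 0F (isLast q) h) ⟩
        suc (posAt q 0F h)                                     ∎)
        where open ≡-Reasoning
      advance q 1F h (jump h′) adv = subst (Next L (posAt q 1F h)) (sym entry) (leaveBlock h h′ (sucModView q) adv)
        where
        entry : rulePos (sucMod (combine q 1F) , h′) ≡ posAt (sucMod q) 0F h′
        entry = trans (cong (λ g → rulePos (g , h′)) (sucMod-combine-fromℕ q)) (rulePos-combine (sucMod q) 0F h′)

      rulePos-next-combine : ∀ q o h → Next L (rulePos (combine q o , h)) (rulePos (ruleNext (combine q o , h)))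
      rulePos-next-combine q o h = subst₂ (Next L) (sym (rulePos-combine q o h)) (cong rulePos (sym (ruleNext-combine q o h)))
                                          (advance q o h (move o (isLast q) h) (moves-advance o (isLast q) h))

      rulePos-next : ∀ v → Next L (rulePos v) (rulePos (ruleNext v))
      rulePos-next (g , h) = subst (λ g → Next L (rulePos (g , h)) (rulePos (ruleNext (g , h))))
                                   (combine-block-parity g) (rulePos-next-combine (block g) (parity g) h)

    ruleCycle : SuccessorCycle L D
    ruleCycle = record
      { next          = ruleNext
      ; next-arc      = λ (g , h) → target-arc (g , h) _
      ; pos           = rulePos
      ; pos-<         = λ (g , h) → posAt-< (block g) (parity g) h
      ; pos-injective = rulePos-injective
      ; origin        = combine {p} Fin.zero 0F , proj₁ start-label
      ; pos-origin    = trans (rulePos-combine Fin.zero 0F (proj₁ start-label)) (cong (position 0) (proj₂ start-label))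
      ; pos-next      = rulePos-next
      }

  evenCycle≀C₄-hamDecomposable : HamDecomposable L D
  evenCycle≀C₄-hamDecomposable =
    successorCycles⇒hamDecomposable (λ j → ruleCycle (rule j) (rules-valid j)) usedByOneRule
    where
    usedByOneRule : ∀ u w → D u w → ∃[ j ] (SuccessorCycle.next (ruleCycle (rule j) (rules-valid j)) u ≡ w ×
                      ∀ j′ → SuccessorCycle.next (ruleCycle (rule j′) (rules-valid j′)) u ≡ w → j′ ≡ j)
    usedByOneRule (g , h) w uw =
      let (mv , target≡w) = arc⇒target uw
          (j , movej≡mv , only-j) = moves-partition (parity g) (isLast (block g)) h mv
      in j , trans (cong (target (g , h)) movej≡mv) target≡w ,
         λ j′ e → only-j j′ (target-injective (s≤s (s≤s z≤n)) (g , h) (trans e (sym target≡w)))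

lemma5p2 : (n : ℕ) → n > 0 → 2 ∣ n →
    HamDecomposable (n * 4) (Wreath (DirCycle n) (DirCycle 4))
lemma5p2 .(zero * 2)  ()  (divides zero refl)
lemma5p2 .(suc m * 2) _   (divides (suc m) refl) = evenCycle≀C₄-hamDecomposable m
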